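{- Let $D=(d_1,\dots,d_n)$ be a non-increasing sequence satisfying $\sum_{i=1}^k d_i\le k(k-1)+d_n(n-k)+1$ for all $k\in\{1,\dots,n\}$. Let $1\le p,q\le n$ (possibly $p=q$), and let $D^*=D+1^{+p}_{+q}$. If $G$ is a simple graph on vertex set $\{v_1,\dots,v_n\}$ with $\deg_G(v_i)=d^*_i$ for all $i$, and $\Gamma(v_p)=\Gamma(v_q)$, then there is an alternating trail in $G$ of odd length $1,3,5$ or $7$ between $v_p$ and $v_q$ which contains one more edge than non-edges.
   Context: $1^{+p}_{+q}$ is the vector with $+1$ in coordinates $p$ and $q$ and $0$ elsewhere (if $p=q$, it adds $2$ to coordinate $p$). $\Gamma(v)$ is the neighbourhood of $v$ in $G$. An alternating trail of length $\ell$ is a sequence of vertices $u_0,\dots,u_\ell$ such that $\{u_i,u_{i+1}\}$ is an edge of $G$ iff $i$ is even (and a non-edge for odd $i$), and the pairs $\{u_i,u_{i+1}\}$, $i<\ell$, are pairwise distinct. -}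

module Defs where

open import Data.Nat using (ℕ; zero; suc; _+_; _*_; _∸_; _≤_; _%_)
open import Data.Fin using (Fin; toℕ; fromℕ; inject₁; _≟_)
import Data.Fin as F
open import Data.Bool using (Bool; true; false; if_then_else_)
open import Data.List using (List; map; take; tabulate)
open import Data.Nat.ListAction using (sum)
open import Data.List using () renaming (allFin to allFinL)
open import Data.Product using (_×_)
open import Data.Sum using (_⊎_)
open import Relation.Nullary using (¬_; does)
open import Relation.Binary.PropositionalEquality using (_≡_; _≢_)

-- A finite simple graph on vertex set Fin n (vertex v_i is index i-1),
-- given by a decidable (Boolean) adjacency relation that is symmetric
-- and irreflexive (no loops, no multiple edges).
record SimpleGraph (n : ℕ) : Set where
  field
    adj     : Fin n → Fin n → Bool
    sym     : ∀ u v → adj u v ≡ adj v u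
    irrefl  : ∀ v → adj v v ≡ false

open SimpleGraph public

deg : ∀ {n} → SimpleGraph n → Fin n → ℕ
deg {n} G v = sum (map (λ w → if adj G v w then 1 else 0) (allFinL n))

ind : ∀ {n} → Fin n → Fin n → ℕ
ind i p = if does (i ≟ p) then 1 else 0

-- D* = D + 1^{+p}_{+q}  (adds 2 at p when p = q)
addPQ : ∀ {n} → (Fin n → ℕ) → Fin n → Fin n → Fin n → ℕ
addPQ D p q i = D i + ind i p + ind i q

NonIncreasing : ∀ {n} → (Fin n → ℕ) → Set
NonIncreasing D = ∀ i j → i F.≤ j → D j ≤ D i

prefixSum : ∀ {n} → (Fin n → ℕ) → ℕ → ℕ
prefixSum {n} D k = sum (take k (tabulate D))

-- the degree-sequence hypothesis of the lemma (D indexed by Fin (suc m), n = suc m,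
-- d_n = D (fromℕ m))
SumCondition : ∀ {m} → (Fin (suc m) → ℕ) → Set
SumCondition {m} D =
  ∀ k → 1 ≤ k → k ≤ suc m →
    prefixSum D k ≤ k * (k ∸ 1) + D (fromℕ m) * (suc m ∸ k) + 1

SamePair : ∀ {n} → Fin n → Fin n → Fin n → Fin n → Set
SamePair a b c d = (a ≡ c × b ≡ d) ⊎ (a ≡ d × b ≡ c)

record AltTrail {n} (G : SimpleGraph n) (a b : Fin n) (ℓ : ℕ) : Set where
  field
    u        : Fin (suc ℓ) → Fin n
    start    : u F.zero ≡ a
    end      : u (fromℕ ℓ) ≡ b
    evenStep : ∀ (i : Fin ℓ) → toℕ i % 2 ≡ 0 → adj G (u (inject₁ i)) (u (F.suc i)) ≡ true
    oddStep  : ∀ (i : Fin ℓ) → toℕ i % 2 ≡ 1 →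
                 (adj G (u (inject₁ i)) (u (F.suc i)) ≡ false) × (u (inject₁ i) ≢ u (F.suc i))
    distinct : ∀ (i j : Fin ℓ) → i ≢ j →
                 ¬ SamePair (u (inject₁ i)) (u (F.suc i)) (u (inject₁ j)) (u (F.suc j))

{-# OPTIONS --safe #-}
-- Suppose no alternating trail of length 3, 5 or 7 joins p and q. Let B be the set of vertices
-- non-adjacent to two distinct neighbours of p, and S = Γ(p) ∪ Γ(B). A missing edge inside S would
-- close such a trail (p x y q, p a b y x q or p a b x y b' a' q), so S is a clique avoiding p and q.
-- Every vertex w outside S has at least d_n + [w = p] + [w = q] neighbours in S: p, q and the
-- vertices of B have all their neighbours in S, and any other vertex outside S is adjacent to all
-- but at most one neighbour of p. Counting the edges at S, with k = |S|,
--   k(k-1) + d_n(n-k) + 2 ≤ ∑_{v∈S} d_v ≤ d_1 + ... + d_k ≤ k(k-1) + d_n(n-k) + 1,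
-- the middle step because D is non-increasing.
module Submission where

open import Defs
open import Data.Nat using (ℕ; suc)
open import Data.Fin using (Fin)
open import Data.Product using (Σ; _×_)
open import Data.Sum using (_⊎_)
open import Relation.Binary.PropositionalEquality using (_≡_)

import Algebra.Properties.CommutativeMonoid.Sum as Sum
open import Algebra.Properties.CommutativeSemigroup using (x∙yz≈y∙xz)
open import Data.Bool using (Bool; true; false; if_then_else_; _∧_)
import Data.Bool.Properties as Bool
open import Data.Empty using (⊥; ⊥-elim)
open import Data.Fin using (zero; suc; toℕ; fromℕ; inject₁; _≟_)
import Data.Fin as F
open import Data.Fin.Properties using (any?; ≤fromℕ; <-cmp; _<?_)
open import Data.List using (List; allFin; filter; cartesianProduct; tabulate)
open import Data.List.Membership.Propositional.Properties using (∈-filter⁺; ∈-cartesianProduct⁺; ∈-allFin)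
open import Data.List.Properties using (map-tabulate)
open import Data.List.Relation.Unary.All as All using (All; []; _∷_; all?)
import Data.Nat as ℕ
open import Data.Nat using (zero; _+_; _*_; _∸_; _≤_; _<_; z≤n; s≤s; s≤s⁻¹; _%_)
open import Data.Nat.DivMod using (m%n<n)
import Data.Nat.ListAction as ListAction
open import Data.Nat.Properties
  using (≤-refl; ≤-trans; ≤-reflexive; +-mono-≤; +-monoˡ-≤; +-monoʳ-≤; m≤m+n; m≤n⇒m≤1+n; 1+n≰n;
         +-assoc; +-comm; +-identityʳ; *-comm; +-∸-assoc; ∸-monoˡ-≤; +-cancelˡ-≤; module ≤-Reasoning;
         +-0-commutativeMonoid; +-commutativeSemigroup)
open import Data.Product using (∃; _,_; proj₁)
open import Data.Sum using (inj₁; inj₂)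
open import Data.Vec using (Vec; []; _∷_; lookup)
open import Function using (_∘_)
open import Level using (0ℓ)
open import Relation.Binary.Definitions using (tri<; tri≈; tri>)
open import Relation.Binary.PropositionalEquality
  using (_≢_; refl; trans; cong; cong₂; subst; ≢-sym; module ≡-Reasoning)
import Relation.Binary.PropositionalEquality as ≡
open import Relation.Nullary using (¬_; Dec; yes; no; does; ¬?)
open import Relation.Nullary.Decidable using (map′; _×-dec_; _⊎-dec_; dec-true; dec-false)
open import Relation.Unary using (Pred; Decidable)

open Sum +-0-commutativeMonoid using (sum; sum-syntax; ∑-distrib-+; ∑-comm; sum-cong-≗; sum-replicate-zero)

[_] : Bool → ℕ
[ b ] = if b then 1 else 0

count : ∀ {n} {P : Pred (Fin n) 0ℓ} → Decidable P → ℕ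
count {n} P? = ∑[ i < n ] [ does (P? i) ]

sum-tabulate : ∀ {n} (f : Fin n → ℕ) → ListAction.sum (tabulate f) ≡ sum f
sum-tabulate {zero} f = refl
sum-tabulate {suc n} f = cong (f zero +_) (sum-tabulate (f ∘ suc))

sum-mono-≤ : ∀ {n} {f g : Fin n → ℕ} → (∀ i → f i ≤ g i) → sum f ≤ sum g
sum-mono-≤ {zero} _ = z≤n
sum-mono-≤ {suc n} f≤g = +-mono-≤ (f≤g zero) (sum-mono-≤ (f≤g ∘ suc))

ind-refl : ∀ {n} (p : Fin n) → ind p p ≡ 1
ind-refl p = cong (if_then 1 else 0) (dec-true (p ≟ p) refl)

ind-≢ : ∀ {n} {i p : Fin n} → i ≢ p → ind i p ≡ 0
ind-≢ {i = i} {p} i≢p = cong (if_then 1 else 0) (dec-false (i ≟ p) i≢p)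

sum-ind : ∀ {n} (p : Fin n) → ∑[ i < n ] ind i p ≡ 1
sum-ind {suc n} zero = cong suc (sum-replicate-zero n)
sum-ind {suc n} (suc p) = sum-ind p

sum-≤-suc : ∀ {n} {f g : Fin n → ℕ} (a : Fin n) → (∀ i → f i ≤ ind i a + g i) → sum f ≤ suc (sum g)
sum-≤-suc {n} {f} {g} a f≤ = ≤-trans (sum-mono-≤ f≤)
  (≤-reflexive (trans (∑-distrib-+ (λ i → ind i a) g) (cong (_+ sum g) (sum-ind a))))

count≤n : ∀ {n} {P : Pred (Fin n) 0ℓ} (P? : Decidable P) → count P? ≤ n
count≤n {zero} P? = z≤n
count≤n {suc n} P? with P? zero
... | yes _ = s≤s (count≤n (P? ∘ suc))
... | no _ = m≤n⇒m≤1+n (count≤n (P? ∘ suc))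

sum-if : ∀ {n} {P : Pred (Fin n) 0ℓ} (P? : Decidable P) (a b : ℕ) →
  ∑[ i < n ] (if does (P? i) then a else b) ≡ count P? * a + (n ∸ count P?) * b
sum-if {zero} P? a b = refl
sum-if {suc n} P? a b with P? zero
... | yes _ = trans (cong (a +_) (sum-if (P? ∘ suc) a b)) (≡.sym (+-assoc a _ _))
... | no _ = begin
    b + ∑[ i < n ] (if does (P? (suc i)) then a else b)  ≡⟨ cong (b +_) (sum-if (P? ∘ suc) a b) ⟩
    b + (k * a + (n ∸ k) * b)                            ≡⟨ x∙yz≈y∙xz +-commutativeSemigroup b (k * a) _ ⟩
    k * a + suc (n ∸ k) * b    ≡⟨ cong (λ c → k * a + c * b) (≡.sym (+-∸-assoc 1 (count≤n (P? ∘ suc)))) ⟩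
    k * a + (suc n ∸ k) * b    ∎
  where
  open ≡-Reasoning
  k = count (P? ∘ suc)

NonIncreasing-tail : ∀ {n} {f : Fin (suc n) → ℕ} → NonIncreasing f → NonIncreasing (f ∘ suc)
NonIncreasing-tail ni i j i≤j = ni (suc i) (suc j) (s≤s i≤j)

prefixSum-tail-≤ : ∀ {n} (f : Fin (suc n) → ℕ) → NonIncreasing f → ∀ k → prefixSum (f ∘ suc) k ≤ prefixSum f k
prefixSum-tail-≤ f ni zero = z≤n
prefixSum-tail-≤ {zero} f ni (suc k) = z≤n
prefixSum-tail-≤ {suc n} f ni (suc k) =
  +-mono-≤ (ni zero (suc zero) z≤n) (prefixSum-tail-≤ (f ∘ suc) (NonIncreasing-tail ni) k)

restricted-sum-≤-prefixSum : ∀ {n} (f : Fin n → ℕ) → NonIncreasing f →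
  {P : Pred (Fin n) 0ℓ} (P? : Decidable P) →
  ∑[ i < n ] (if does (P? i) then f i else 0) ≤ prefixSum f (count P?)
restricted-sum-≤-prefixSum {zero} f ni P? = z≤n
restricted-sum-≤-prefixSum {suc n} f ni P? with P? zero
... | yes _ = +-monoʳ-≤ (f zero) (restricted-sum-≤-prefixSum (f ∘ suc) (NonIncreasing-tail ni) (P? ∘ suc))
... | no _ = ≤-trans (restricted-sum-≤-prefixSum (f ∘ suc) (NonIncreasing-tail ni) (P? ∘ suc))
                     (prefixSum-tail-≤ f ni (count (P? ∘ suc)))

parity : ∀ m → m % 2 ≡ 0 ⊎ m % 2 ≡ 1
parity m with m % 2 | m%n<n m 2
... | 0 | _ = inj₁ refl
... | 1 | _ = inj₂ refl
... | suc (suc _) | s≤s (s≤s ())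

SamePair-flip : ∀ {n} {a b c d : Fin n} → SamePair a b c d → SamePair c d a b
SamePair-flip (inj₁ (a≡c , b≡d)) = inj₁ (≡.sym a≡c , ≡.sym b≡d)
SamePair-flip (inj₂ (a≡d , b≡c)) = inj₂ (≡.sym b≡c , ≡.sym a≡d)

¬SamePair : ∀ {n} {a b c d : Fin n} → a ≢ c ⊎ b ≢ d → a ≢ d ⊎ b ≢ c → ¬ SamePair a b c d
¬SamePair (inj₁ a≢c) _ (inj₁ (a≡c , _)) = a≢c a≡c
¬SamePair (inj₂ b≢d) _ (inj₁ (_ , b≡d)) = b≢d b≡d
¬SamePair _ (inj₁ a≢d) (inj₂ (a≡d , _)) = a≢d a≡d
¬SamePair _ (inj₂ b≢c) (inj₂ (_ , b≡c)) = b≢c b≡c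

SamePair? : ∀ {n} (a b c d : Fin n) → Dec (SamePair a b c d)
SamePair? a b c d = ((a ≟ c) ×-dec (b ≟ d)) ⊎-dec ((a ≟ d) ×-dec (b ≟ c))

∃-Vec? : ∀ {n} k {P : Vec (Fin n) k → Set} → (∀ vs → Dec (P vs)) → Dec (∃ P)
∃-Vec? zero P? = map′ ([] ,_) (λ { ([] , p) → p }) (P? [])
∃-Vec? (suc k) P? =
  map′ (λ (x , vs , p) → x ∷ vs , p) (λ { (x ∷ vs , p) → x , vs , p })
       (any? λ x → ∃-Vec? k (λ vs → P? (x ∷ vs)))

module Graph {n} (G : SimpleGraph n) where

  Edge : Fin n → Fin n → Set
  Edge x y = adj G x y ≡ true

  NonEdge : Fin n → Fin n → Set
  NonEdge x y = adj G x y ≡ false × x ≢ y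

  Edge? : ∀ x y → Dec (Edge x y)
  Edge? x y = adj G x y Bool.≟ true

  NonEdge? : ∀ x y → Dec (NonEdge x y)
  NonEdge? x y = (adj G x y Bool.≟ false) ×-dec ¬? (x ≟ y)

  Edge-sym : ∀ {x y} → Edge x y → Edge y x
  Edge-sym {x} {y} = trans (sym G y x)

  NonEdge-sym : ∀ {x y} → NonEdge x y → NonEdge y x
  NonEdge-sym {x} {y} (xy , x≢y) = trans (sym G y x) xy , ≢-sym x≢y

  false⇒¬Edge : ∀ {x y} → adj G x y ≡ false → ¬ Edge x y
  false⇒¬Edge xy e with trans (≡.sym e) xy
  ... | ()

  Edge⇒≢ : ∀ {x y} → Edge x y → x ≢ y
  Edge⇒≢ {x} xy refl = false⇒¬Edge (irrefl G x) xy

  adj-separates : ∀ {x y z} → Edge x y → adj G x z ≡ false → y ≢ z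
  adj-separates xy xz refl = false⇒¬Edge xz xy

  Edge⇒¬SamePair : ∀ {a b c d} → Edge a b → adj G c d ≡ false → ¬ SamePair a b c d
  Edge⇒¬SamePair ab cd (inj₁ (refl , refl)) = adj-separates ab cd refl
  Edge⇒¬SamePair ab cd (inj₂ (refl , refl)) = adj-separates (Edge-sym ab) cd refl

  deg≡sum : ∀ v → deg G v ≡ ∑[ w < n ] [ adj G v w ]
  deg≡sum v = trans (cong ListAction.sum (map-tabulate (λ w → w) (λ w → [ adj G v w ])))
                    (sum-tabulate (λ w → [ adj G v w ]))

  module _ {P : Pred (Fin n) 0ℓ} (P? : Decidable P) where

    degreeIn : Fin n → ℕ
    degreeIn w = ∑[ v < n ] [ does (P? v) ∧ adj G w v ]

    sum-deg≡sum-degreeIn : ∑[ v < n ] (if does (P? v) then deg G v else 0) ≡ ∑[ w < n ] degreeIn w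
    sum-deg≡sum-degreeIn = begin
      ∑[ v < n ] (if does (P? v) then deg G v else 0)    ≡⟨ sum-cong-≗ restricted-deg ⟩
      ∑[ v < n ] ∑[ w < n ] [ does (P? v) ∧ adj G v w ]  ≡⟨ ∑-comm (λ v w → [ does (P? v) ∧ adj G v w ]) ⟩
      ∑[ w < n ] ∑[ v < n ] [ does (P? v) ∧ adj G v w ]  ≡⟨ sum-cong-≗ (λ w → sum-cong-≗ λ v →
                                                              cong (λ b → [ does (P? v) ∧ b ]) (sym G v w)) ⟩
      ∑[ w < n ] degreeIn w                               ∎
      where
      open ≡-Reasoning
      restricted-deg : ∀ v → (if does (P? v) then deg G v else 0) ≡ ∑[ w < n ] [ does (P? v) ∧ adj G v w ]
      restricted-deg v with P? v
      ... | yes _ = deg≡sum v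
      ... | no _ = ≡.sym (sum-replicate-zero n)

    neighbours⊆⇒deg≤degreeIn : ∀ {w} → (∀ {v} → Edge w v → P v) → deg G w ≤ degreeIn w
    neighbours⊆⇒deg≤degreeIn {w} Γw⊆P = subst (_≤ degreeIn w) (≡.sym (deg≡sum w)) (sum-mono-≤ pointwise)
      where
      pointwise : ∀ v → [ adj G w v ] ≤ [ does (P? v) ∧ adj G w v ]
      pointwise v with adj G w v in wv | P? v
      ... | false | _ = z≤n
      ... | true | yes _ = ≤-refl
      ... | true | no ¬Pv = ⊥-elim (¬Pv (Γw⊆P wv))

    deg≤suc-degreeIn : ∀ {u w} a → (∀ {v} → Edge u v → v ≢ a → P v × Edge w v) → deg G u ≤ suc (degreeIn w)
    deg≤suc-degreeIn {u} {w} a covered = subst (_≤ suc (degreeIn w)) (≡.sym (deg≡sum u)) (sum-≤-suc a pointwise)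
      where
      pointwise : ∀ v → [ adj G u v ] ≤ ind v a + [ does (P? v) ∧ adj G w v ]
      pointwise v with adj G u v in uv | v ≟ a
      ... | false | _ = z≤n
      ... | true | yes refl = s≤s z≤n
      ... | true | no v≢a with covered uv v≢a
      ...   | Pv , wv rewrite dec-true (P? v) Pv | wv = ≤-refl

    IsClique : Set
    IsClique = ∀ {x y} → P x → P y → x ≢ y → Edge x y

    clique⇒count≤suc-degreeIn : IsClique → ∀ {w} → P w → count P? ≤ suc (degreeIn w)
    clique⇒count≤suc-degreeIn clique {w} Pw = sum-≤-suc w pointwise
      where
      pointwise : ∀ v → [ does (P? v) ] ≤ ind v w + [ does (P? v) ∧ adj G w v ]
      pointwise v with P? v | v ≟ w
      ... | no _ | _ = z≤n
      ... | yes _ | yes refl = s≤s z≤n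
      ... | yes Pv | no v≢w rewrite clique Pw Pv (≢-sym v≢w) = ≤-refl

  AlternatingStep : ℕ → Fin n → Fin n → Set
  AlternatingStep zero = Edge
  AlternatingStep (suc _) = NonEdge

  AlternatingStep? : ∀ r x y → Dec (AlternatingStep r x y)
  AlternatingStep? zero = Edge?
  AlternatingStep? (suc _) = NonEdge?

  OrderedSameParity : ∀ {ℓ} → Fin ℓ × Fin ℓ → Set
  OrderedSameParity (i , j) = i F.< j × toℕ i % 2 ≡ toℕ j % 2

  orderedSameParity? : ∀ {ℓ} → Decidable (OrderedSameParity {ℓ})
  orderedSameParity? (i , j) = (i <? j) ×-dec (toℕ i % 2 ℕ.≟ toℕ j % 2)

  sameParityPairs : ∀ ℓ → List (Fin ℓ × Fin ℓ)
  sameParityPairs ℓ = filter orderedSameParity? (cartesianProduct (allFin ℓ) (allFin ℓ))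

  module _ {ℓ} (u : Fin (suc ℓ) → Fin n) where

    StepAt : Fin ℓ → Set
    StepAt i = AlternatingStep (toℕ i % 2) (u (inject₁ i)) (u (suc i))

    StepsDiffer : Fin ℓ × Fin ℓ → Set
    StepsDiffer (i , j) = ¬ SamePair (u (inject₁ i)) (u (suc i)) (u (inject₁ j)) (u (suc j))

    -- Steps of different parity differ automatically (one is an edge, the other is not),
    -- so only pairs of steps of equal parity need to be checked.
    IsAltTrail : Set
    IsAltTrail = All StepAt (allFin ℓ) × All StepsDiffer (sameParityPairs ℓ)

    isAltTrail? : Dec IsAltTrail
    isAltTrail? =
      all? (λ i → AlternatingStep? (toℕ i % 2) (u (inject₁ i)) (u (suc i))) (allFin ℓ)
      ×-dec all? (λ (i , j) → ¬? (SamePair? (u (inject₁ i)) (u (suc i)) (u (inject₁ j)) (u (suc j))))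
                 (sameParityPairs ℓ)

    toAltTrail : ∀ {a b} → u zero ≡ a → u (fromℕ ℓ) ≡ b → IsAltTrail → AltTrail G a b ℓ
    toAltTrail start end (steps , differ) = record
      { u = u ; start = start ; end = end
      ; evenStep = even-step
      ; oddStep = odd-step
      ; distinct = distinct
      }
      where
      step-of-parity : ∀ {r} i → toℕ i % 2 ≡ r → AlternatingStep r (u (inject₁ i)) (u (suc i))
      step-of-parity i refl = All.lookup steps (∈-allFin i)

      even-step : ∀ i → toℕ i % 2 ≡ 0 → Edge (u (inject₁ i)) (u (suc i))
      even-step = step-of-parity

      odd-step : ∀ i → toℕ i % 2 ≡ 1 → NonEdge (u (inject₁ i)) (u (suc i))
      odd-step = step-of-parity

      differ-ordered : ∀ {i j} → i F.< j → toℕ i % 2 ≡ toℕ j % 2 → StepsDiffer (i , j)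
      differ-ordered {i} {j} i<j par = All.lookup differ
        (∈-filter⁺ orderedSameParity? (∈-cartesianProduct⁺ (∈-allFin i) (∈-allFin j)) (i<j , par))

      differ-same-parity : ∀ i j → i ≢ j → toℕ i % 2 ≡ toℕ j % 2 → StepsDiffer (i , j)
      differ-same-parity i j i≢j par with <-cmp i j
      ... | tri< i<j _ _ = differ-ordered i<j par
      ... | tri≈ _ i≡j _ = ⊥-elim (i≢j i≡j)
      ... | tri> _ _ j<i = differ-ordered j<i (≡.sym par) ∘ SamePair-flip

      distinct : ∀ i j → i ≢ j → StepsDiffer (i , j)
      distinct i j i≢j with parity (toℕ i) | parity (toℕ j)
      ... | inj₁ i-even | inj₁ j-even = differ-same-parity i j i≢j (trans i-even (≡.sym j-even))
      ... | inj₂ i-odd | inj₂ j-odd = differ-same-parity i j i≢j (trans i-odd (≡.sym j-odd))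
      ... | inj₁ i-even | inj₂ j-odd = Edge⇒¬SamePair (even-step i i-even) (proj₁ (odd-step j j-odd))
      ... | inj₂ i-odd | inj₁ j-even =
        Edge⇒¬SamePair (even-step j j-even) (proj₁ (odd-step i i-odd)) ∘ SamePair-flip

  -- Trails given by their vertex sequence, so that their existence is decidable.
  AltTrailVertices : Fin n → Fin n → ℕ → Set
  AltTrailVertices a b ℓ =
    Σ (Vec (Fin n) (suc ℓ)) λ vs → lookup vs zero ≡ a × lookup vs (fromℕ ℓ) ≡ b × IsAltTrail (lookup vs)

  altTrailVertices? : ∀ a b ℓ → Dec (AltTrailVertices a b ℓ)
  altTrailVertices? a b ℓ =
    ∃-Vec? (suc ℓ) λ vs → (lookup vs zero ≟ a) ×-dec (lookup vs (fromℕ ℓ) ≟ b) ×-dec isAltTrail? (lookup vs)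

  fromVertices : ∀ {a b ℓ} → AltTrailVertices a b ℓ → AltTrail G a b ℓ
  fromVertices (vs , start , end , trail) = toAltTrail (lookup vs) start end trail

  ShortOddAltTrail : Fin n → Fin n → Set
  ShortOddAltTrail a b = Σ ℕ (λ ℓ → (ℓ ≡ 1 ⊎ ℓ ≡ 3 ⊎ ℓ ≡ 5 ⊎ ℓ ≡ 7) × AltTrail G a b ℓ)

  shortOddAltTrail : ∀ {a b} →
    (¬ AltTrailVertices a b 3 → ¬ AltTrailVertices a b 5 → ¬ AltTrailVertices a b 7 → ⊥) →
    ShortOddAltTrail a b
  shortOddAltTrail {a} {b} none =
    first (altTrailVertices? a b 3) (altTrailVertices? a b 5) (altTrailVertices? a b 7)
    where
    first : Dec (AltTrailVertices a b 3) → Dec (AltTrailVertices a b 5) → Dec (AltTrailVertices a b 7) →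
            ShortOddAltTrail a b
    first (yes t₃) _ _ = 3 , inj₂ (inj₁ refl) , fromVertices t₃
    first (no _) (yes t₅) _ = 5 , inj₂ (inj₂ (inj₁ refl)) , fromVertices t₅
    first (no _) (no _) (yes t₇) = 7 , inj₂ (inj₂ (inj₂ refl)) , fromVertices t₇
    first (no no₃) (no no₅) (no no₇) = ⊥-elim (none no₃ no₅ no₇)

module TwinsWithoutShortTrails {n} (G : SimpleGraph n) (p q : Fin n)
  (twins : ∀ w → adj G p w ≡ adj G q w)
  (no₃ : ¬ Graph.AltTrailVertices G p q 3)
  (no₅ : ¬ Graph.AltTrailVertices G p q 5)
  (no₇ : ¬ Graph.AltTrailVertices G p q 7) where

  open Graph G

  Γp⇒Γq : ∀ {x} → Edge p x → Edge q x
  Γp⇒Γq {x} = trans (≡.sym (twins x))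

  trail₃ : ∀ {x y} → Edge p x → Edge p y → NonEdge x y → AltTrailVertices p q 3
  trail₃ {x} {y} px py (xy , x≢y) = p ∷ x ∷ y ∷ q ∷ [] , refl , refl ,
    (px ∷ (xy , x≢y) ∷ Edge-sym (Γp⇒Γq py) ∷ []) ,
    (¬SamePair (inj₁ (Edge⇒≢ py)) (inj₂ x≢y) ∷ [])

  Γp-clique : ∀ {x y} → Edge p x → Edge p y → x ≢ y → Edge x y
  Γp-clique {x} {y} px py x≢y with adj G x y in xy
  ... | true = refl
  ... | false = ⊥-elim (no₃ (trail₃ px py (xy , x≢y)))

  Misses : Fin n → Fin n → Set
  Misses b a = Edge p a × NonEdge b a

  MissesTwo : Pred (Fin n) 0ℓ
  MissesTwo b = Σ (Fin n) λ a₁ → Σ (Fin n) λ a₂ → a₁ ≢ a₂ × Misses b a₁ × Misses b a₂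

  S : Pred (Fin n) 0ℓ
  S x = Edge p x ⊎ Σ (Fin n) λ b → MissesTwo b × Edge x b

  Misses? : ∀ b a → Dec (Misses b a)
  Misses? b a = Edge? p a ×-dec NonEdge? b a

  MissesTwo? : Decidable MissesTwo
  MissesTwo? b = any? λ a₁ → any? λ a₂ → ¬? (a₁ ≟ a₂) ×-dec Misses? b a₁ ×-dec Misses? b a₂

  S? : Decidable S
  S? x = Edge? p x ⊎-dec any? (λ b → MissesTwo? b ×-dec Edge? x b)

  MissesTwo⇒¬Γp : ∀ {b} → MissesTwo b → adj G p b ≡ false
  MissesTwo⇒¬Γp {b} (a , _ , _ , (pa , ba , b≢a) , _) with adj G p b in pb
  ... | false = refl
  ... | true = ⊥-elim (false⇒¬Edge ba (Edge-sym (Γp-clique pa pb (≢-sym b≢a))))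

  MissesTwo⇒≢p : ∀ {b} → MissesTwo b → b ≢ p
  MissesTwo⇒≢p (_ , _ , _ , (pa , ba , _) , _) refl = false⇒¬Edge ba pa

  MissesTwo⇒≢q : ∀ {b} → MissesTwo b → b ≢ q
  MissesTwo⇒≢q (_ , _ , _ , (pa , ba , _) , _) refl = false⇒¬Edge ba (Γp⇒Γq pa)

  missesOther : ∀ {b} → MissesTwo b → ∀ a → Σ (Fin n) λ a' → Misses b a' × a' ≢ a
  missesOther (a₁ , a₂ , a₁≢a₂ , m₁ , m₂) a with a₁ ≟ a
  ... | yes refl = a₂ , m₂ , ≢-sym a₁≢a₂
  ... | no a₁≢a = a₁ , m₁ , a₁≢a

  p∉S : ¬ S p
  p∉S (inj₁ pp) = Edge⇒≢ pp refl
  p∉S (inj₂ (b , mb , pb)) = false⇒¬Edge (MissesTwo⇒¬Γp mb) pb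

  q∉S : ¬ S q
  q∉S (inj₁ pq) = Edge⇒≢ (Γp⇒Γq pq) refl
  q∉S (inj₂ (b , mb , qb)) = false⇒¬Edge (trans (≡.sym (twins b)) (MissesTwo⇒¬Γp mb)) qb

  Γp⊆S : ∀ {v} → Edge p v → S v
  Γp⊆S = inj₁

  Γq⊆S : ∀ {v} → Edge q v → S v
  Γq⊆S {v} qv = inj₁ (trans (twins v) qv)

  ∈S⇒≢p : ∀ {x} → S x → x ≢ p
  ∈S⇒≢p x∈S refl = p∉S x∈S

  ∈S⇒≢q : ∀ {x} → S x → x ≢ q
  ∈S⇒≢q x∈S refl = q∉S x∈S

  trail₅ : ∀ {x y b} → Edge p x → MissesTwo b → Edge y b → adj G p y ≡ false → NonEdge x y →
           AltTrailVertices p q 5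
  trail₅ {x} {y} {b} px mb yb py xy with missesOther mb x
  ... | a , (pa , ba) , a≢x = p ∷ a ∷ b ∷ y ∷ x ∷ q ∷ [] , refl , refl ,
    (pa ∷ NonEdge-sym ba ∷ Edge-sym yb ∷ NonEdge-sym xy ∷ Edge-sym (Γp⇒Γq px) ∷ []) ,
    (¬SamePair (inj₁ (≢-sym (MissesTwo⇒≢p mb))) (inj₁ (≢-sym (∈S⇒≢p y∈S))) ∷
     ¬SamePair (inj₁ (Edge⇒≢ px)) (inj₂ a≢x) ∷
     ¬SamePair (inj₁ (adj-separates pa py)) (inj₁ a≢x) ∷
     ¬SamePair (inj₂ (∈S⇒≢q y∈S)) (inj₁ (MissesTwo⇒≢q mb)) ∷ [])
    where
    y∈S : S y
    y∈S = inj₂ (b , mb , yb)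

  Γp-adj-S : ∀ {x y} → Edge p x → S y → x ≢ y → Edge x y
  Γp-adj-S px (inj₁ py) x≢y = Γp-clique px py x≢y
  Γp-adj-S {x} {y} px (inj₂ (b , mb , yb)) x≢y with adj G p y in py
  ... | true = Γp-clique px py x≢y
  ... | false with adj G x y in xy
  ...   | true = refl
  ...   | false = ⊥-elim (no₅ (trail₅ px mb yb py (xy , x≢y)))

  MissesTwo⇒∉S : ∀ {b} → MissesTwo b → ¬ S b
  MissesTwo⇒∉S (a , _ , _ , (pa , ba , b≢a) , _) b∈S = false⇒¬Edge ba (Edge-sym (Γp-adj-S pa b∈S (≢-sym b≢a)))

  trail₇ : ∀ {x y b b'} → MissesTwo b → Edge x b → MissesTwo b' → Edge y b' →
           adj G p x ≡ false → adj G p y ≡ false → NonEdge x y → AltTrailVertices p q 7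
  trail₇ {x} {y} {b} {b'} mb@(a , _ , _ , (pa , ba) , _) xb mb' yb' px py (xy , x≢y)
    with missesOther mb' a
  ... | a' , (pa' , b'a') , a'≢a = p ∷ a ∷ b ∷ x ∷ y ∷ b' ∷ a' ∷ q ∷ [] , refl , refl ,
    (pa ∷ NonEdge-sym ba ∷ Edge-sym xb ∷ (xy , x≢y) ∷ yb' ∷ b'a' ∷ Edge-sym (Γp⇒Γq pa') ∷ []) ,
    (¬SamePair (inj₁ (≢-sym (MissesTwo⇒≢p mb))) (inj₁ (≢-sym (∈S⇒≢p x∈S))) ∷
     ¬SamePair (inj₁ (≢-sym (∈S⇒≢p y∈S))) (inj₁ (≢-sym (MissesTwo⇒≢p mb'))) ∷
     ¬SamePair (inj₁ (Edge⇒≢ pa')) (inj₂ (≢-sym a'≢a)) ∷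
     ¬SamePair (inj₁ (adj-separates pa px)) (inj₁ (adj-separates pa py)) ∷
     ¬SamePair (inj₁ (adj-separates pa (MissesTwo⇒¬Γp mb'))) (inj₁ (≢-sym a'≢a)) ∷
     ¬SamePair (inj₁ b≢y) (inj₂ x≢y) ∷
     ¬SamePair (inj₂ (∈S⇒≢q x∈S)) (inj₁ (MissesTwo⇒≢q mb)) ∷
     ¬SamePair (inj₂ (≢-sym (adj-separates pa' py))) (inj₁ (≢-sym (adj-separates pa' px))) ∷
     ¬SamePair (inj₁ (≢-sym (adj-separates pa' py))) (inj₁ (∈S⇒≢q y∈S)) ∷ [])
    where
    x∈S : S x
    x∈S = inj₂ (b , mb , xb)
    y∈S : S y
    y∈S = inj₂ (b' , mb' , yb')
    b≢y : b ≢ y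
    b≢y refl = MissesTwo⇒∉S mb y∈S

  S-clique : IsClique S?
  S-clique (inj₁ px) y∈S x≢y = Γp-adj-S px y∈S x≢y
  S-clique x∈S (inj₁ py) x≢y = Edge-sym (Γp-adj-S py x∈S (≢-sym x≢y))
  S-clique {x} {y} x∈S@(inj₂ (b , mb , xb)) y∈S@(inj₂ (b' , mb' , yb')) x≢y with adj G p x in px
  ... | true = Γp-adj-S px y∈S x≢y
  ... | false with adj G p y in py
  ...   | true = Edge-sym (Γp-adj-S py x∈S (≢-sym x≢y))
  ...   | false with adj G x y in xy
  ...     | true = refl
  ...     | false = ⊥-elim (no₇ (trail₇ mb xb mb' yb' px py (xy , x≢y)))

  ∉S⇒adjacent-unless-misses : ∀ {w v} → ¬ S w → Edge p v → ¬ Misses w v → Edge w v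
  ∉S⇒adjacent-unless-misses {w} {v} w∉S pv ¬mv with adj G w v
  ... | true = refl
  ... | false = ⊥-elim (¬mv (pv , refl , λ { refl → w∉S (inj₁ pv) }))

  outside-S : ∀ {w} → ¬ S w → deg G w ≤ degreeIn S? w ⊎ deg G p ≤ suc (degreeIn S? w)
  outside-S {w} w∉S with MissesTwo? w
  ... | yes mw = inj₁ (neighbours⊆⇒deg≤degreeIn S? λ wv → inj₂ (w , mw , Edge-sym wv))
  ... | no ¬mw with any? (Misses? w)
  ...   | yes (a , ma) = inj₂ (deg≤suc-degreeIn S? a λ pv v≢a →
            inj₁ pv , ∉S⇒adjacent-unless-misses w∉S pv λ mv → ¬mw (a , _ , ≢-sym v≢a , ma , mv))
  ...   | no ¬∃m = inj₂ (deg≤suc-degreeIn S? p λ pv _ →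
            inj₁ pv , ∉S⇒adjacent-unless-misses w∉S pv λ mv → ¬∃m (_ , mv))

module DegreeSequence {m} (D : Fin (suc m) → ℕ) (non-increasing : NonIncreasing D) (sum-condition : SumCondition D)
  (G : SimpleGraph (suc m)) (p q : Fin (suc m)) (deg≡D* : ∀ i → deg G i ≡ addPQ D p q i) where

  open Graph G

  δ : ℕ
  δ = D (fromℕ m)

  δ≤D : ∀ i → δ ≤ D i
  δ≤D i = non-increasing i (fromℕ m) (≤fromℕ i)

  δ+ind≤deg : ∀ i → δ + ind i p + ind i q ≤ deg G i
  δ+ind≤deg i = subst (δ + ind i p + ind i q ≤_) (≡.sym (deg≡D* i)) (+-monoˡ-≤ (ind i q) (+-monoˡ-≤ (ind i p) (δ≤D i)))

  +ind≡ : ∀ a {w} → w ≢ p → w ≢ q → a + ind w p + ind w q ≡ a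
  +ind≡ a {w} w≢p w≢q = begin
    a + ind w p + ind w q  ≡⟨ cong₂ (λ i j → a + i + j) (ind-≢ w≢p) (ind-≢ w≢q) ⟩
    a + 0 + 0              ≡⟨ trans (+-identityʳ (a + 0)) (+-identityʳ a) ⟩
    a                      ∎
    where open ≡-Reasoning

  deg≡D : ∀ {w} → w ≢ p → w ≢ q → deg G w ≡ D w
  deg≡D {w} w≢p w≢q = trans (deg≡D* w) (+ind≡ (D w) w≢p w≢q)

  D<deg-p : D p < deg G p
  D<deg-p = begin
    suc (D p)                ≡⟨ +-comm 1 (D p) ⟩
    D p + 1                  ≡⟨ cong (D p +_) (≡.sym (ind-refl p)) ⟩
    D p + ind p p            ≤⟨ m≤m+n _ _ ⟩
    D p + ind p p + ind p q  ≡⟨ ≡.sym (deg≡D* p) ⟩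
    deg G p                  ∎
    where open ≤-Reasoning

  prefixSum-bound : ∀ k → k ≤ suc m → prefixSum D k ≤ k * (k ∸ 1) + δ * (suc m ∸ k) + 1
  prefixSum-bound zero _ = z≤n
  prefixSum-bound (suc k) k≤n = sum-condition (suc k) (s≤s z≤n) k≤n

  module _ {P : Pred (Fin (suc m)) 0ℓ} (P? : Decidable P) (clique : IsClique P?) (p∉P : ¬ P p) (q∉P : ¬ P q)
    (Γp⊆P : ∀ {v} → Edge p v → P v) (Γq⊆P : ∀ {v} → Edge q v → P v)
    (outside : ∀ {w} → ¬ P w → deg G w ≤ degreeIn P? w ⊎ deg G p ≤ suc (degreeIn P? w)) where

    k : ℕ
    k = count P?

    base : Fin (suc m) → ℕ
    base w = if does (P? w) then k ∸ 1 else δ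

    lower : Fin (suc m) → ℕ
    lower w = base w + ind w p + ind w q

    deg≤degreeIn-at-p⊎q : ∀ {w} → w ≡ p ⊎ w ≡ q → deg G w ≤ degreeIn P? w
    deg≤degreeIn-at-p⊎q (inj₁ refl) = neighbours⊆⇒deg≤degreeIn P? Γp⊆P
    deg≤degreeIn-at-p⊎q (inj₂ refl) = neighbours⊆⇒deg≤degreeIn P? Γq⊆P

    δ≤degreeIn : ∀ {w} → ¬ P w → w ≢ p → w ≢ q → δ ≤ degreeIn P? w
    δ≤degreeIn {w} ¬Pw w≢p w≢q with outside ¬Pw
    ... | inj₁ deg≤ = ≤-trans (δ≤D w) (subst (_≤ degreeIn P? w) (deg≡D w≢p w≢q) deg≤)
    ... | inj₂ deg-p≤ = ≤-trans (δ≤D p) (s≤s⁻¹ (≤-trans D<deg-p deg-p≤))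

    lower≤degreeIn : ∀ w → lower w ≤ degreeIn P? w
    lower≤degreeIn w with P? w | (w ≟ p) ⊎-dec (w ≟ q)
    ... | yes Pw | _ =
      subst (_≤ degreeIn P? w) (≡.sym (+ind≡ (k ∸ 1) {w} (λ { refl → p∉P Pw }) (λ { refl → q∉P Pw })))
            (∸-monoˡ-≤ 1 (clique⇒count≤suc-degreeIn P? clique Pw))
    ... | no _ | yes w∈pq = ≤-trans (δ+ind≤deg w) (deg≤degreeIn-at-p⊎q w∈pq)
    ... | no ¬Pw | no w∉pq =
      subst (_≤ degreeIn P? w) (≡.sym (+ind≡ δ (w∉pq ∘ inj₁) (w∉pq ∘ inj₂)))
            (δ≤degreeIn ¬Pw (w∉pq ∘ inj₁) (w∉pq ∘ inj₂))

    sum-lower : ∑[ w < suc m ] lower w ≡ k * (k ∸ 1) + δ * (suc m ∸ k) + 2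
    sum-lower = begin
      ∑[ w < suc m ] lower w
        ≡⟨ trans (∑-distrib-+ (λ w → base w + ind w p) (λ w → ind w q))
                 (cong (_+ ∑[ w < suc m ] ind w q) (∑-distrib-+ base (λ w → ind w p))) ⟩
      sum base + ∑[ w < suc m ] ind w p + ∑[ w < suc m ] ind w q
        ≡⟨ cong₂ (λ i j → sum base + i + j) (sum-ind p) (sum-ind q) ⟩
      sum base + 1 + 1
        ≡⟨ +-assoc (sum base) 1 1 ⟩
      sum base + 2
        ≡⟨ cong (_+ 2) (trans (sum-if P? (k ∸ 1) δ) (cong (k * (k ∸ 1) +_) (*-comm (suc m ∸ k) δ))) ⟩
      k * (k ∸ 1) + δ * (suc m ∸ k) + 2 ∎
      where open ≡-Reasoning

    restricted-deg≡D : ∀ v → (if does (P? v) then deg G v else 0) ≡ (if does (P? v) then D v else 0)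
    restricted-deg≡D v with P? v
    ... | yes Pv = deg≡D (λ { refl → p∉P Pv }) (λ { refl → q∉P Pv })
    ... | no _ = refl

    clique-contradicts-SumCondition : ⊥
    clique-contradicts-SumCondition = 1+n≰n (+-cancelˡ-≤ X 2 1 X+2≤X+1)
      where
      X = k * (k ∸ 1) + δ * (suc m ∸ k)
      X+2≤X+1 : X + 2 ≤ X + 1
      X+2≤X+1 = begin
        X + 2                                                  ≡⟨ ≡.sym sum-lower ⟩
        ∑[ w < suc m ] lower w                                 ≤⟨ sum-mono-≤ lower≤degreeIn ⟩
        ∑[ w < suc m ] degreeIn P? w                           ≡⟨ ≡.sym (sum-deg≡sum-degreeIn P?) ⟩
        ∑[ v < suc m ] (if does (P? v) then deg G v else 0)    ≡⟨ sum-cong-≗ restricted-deg≡D ⟩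
        ∑[ v < suc m ] (if does (P? v) then D v else 0)        ≤⟨ restricted-sum-≤-prefixSum D non-increasing P? ⟩
        prefixSum D k                                          ≤⟨ prefixSum-bound k (count≤n P?) ⟩
        X + 1                                                  ∎
        where open ≤-Reasoning

lemma4p5 : (m : ℕ) (D : Fin (suc m) → ℕ) →
    NonIncreasing D → SumCondition D →
    (p q : Fin (suc m)) (G : SimpleGraph (suc m)) →
    (∀ i → deg G i ≡ addPQ D p q i) →
    (∀ w → adj G p w ≡ adj G q w) →
    Σ ℕ (λ ℓ → (ℓ ≡ 1 ⊎ ℓ ≡ 3 ⊎ ℓ ≡ 5 ⊎ ℓ ≡ 7) × AltTrail G p q ℓ)
lemma4p5 m D non-increasing sum-condition p q G deg≡D* twins =
  Graph.shortOddAltTrail G λ no₃ no₅ no₇ →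
    let open TwinsWithoutShortTrails G p q twins no₃ no₅ no₇
        open DegreeSequence D non-increasing sum-condition G p q deg≡D*
    in clique-contradicts-SumCondition S? S-clique p∉S q∉S Γp⊆S Γq⊆S outside-S
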